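{- For every implicit knowledge-based HMS model $\overline{\mathsf{M}}^*$, the FH$^*$-transform $FH^*(\overline{\mathsf{M}}^*)$ is an FH model for $\mathsf{At}$ (i.e., partitional and propositionally determined).
   Context: Fix non-empty sets $\mathsf{At}$, $I$. Language $\mathcal{L}_{\mathsf{At}}$: $\varphi::=\top\mid p\mid\neg\varphi\mid\varphi\wedge\psi\mid\ell_i\varphi\mid a_i\varphi\mid k_i\varphi$; $\mathsf{At}(\varphi)$ = atoms in $\varphi$; $\mathcal{L}_\Phi=\{\varphi:\mathsf{At}(\varphi)\subseteq\Phi\}$. Implicit knowledge-based HMS model $\langle I,\{S_\Phi\},(r^\Phi_\Psi),(\Lambda_i),(\alpha_i),v\rangle$: non-empty pairwise disjoint spaces $S_\Phi$ ($\Phi\subseteq\mathsf{At}$), ordered $S_{\Phi'}\succeq S_\Phi$ iff $\Phi\subseteq\Phi'$; $\Omega=\bigcup_\Phi S_\Phi$; surjections $r^\Phi_\Psi:S_\Phi\to S_\Psi$, $r^\Phi_\Phi=\mathrm{id}$, $r^\Phi_\Upsilon=r^\Psi_\Upsilon\circ r^\Phi_\Psi$; $\omega_\Psi=r^\Phi_\Psi(\omega)$; $v$ maps atoms to events (sets of the form $\bigcup_{\Phi\subseteq\Psi}(r^\Psi_\Phi)^{ -1}(D)$, $D\subseteq S_\Phi$); $\Lambda_i:\Omega\to2^\Omega\setminus\{\emptyset\}$ with Reflexivity ($\omega\in\Lambda_i(\omega)$), Stationarity ($\omega'\in\Lambda_i(\omega)\Rightarrow\Lambda_i(\omega')=\Lambda_i(\omega)$),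 Projections Preserve Implicit Knowledge ($\omega\in S_\Phi$, $\Psi\subseteq\Phi\Rightarrow r^\Phi_\Psi(\Lambda_i(\omega))=\Lambda_i(\omega_\Psi)$); $\alpha_i:\Omega\to\{S_\Phi\}$ with (O) $\omega\in S_\Phi\Rightarrow\alpha_i(\omega)\preceq S_\Phi$; (I) $\omega'\in\Lambda_i(\omega)\Rightarrow\alpha_i(\omega')=\alpha_i(\omega)$; (II) $\omega\in S_\Phi$, $S_\Psi\preceq\alpha_i(\omega)\Rightarrow\alpha_i(\omega_\Psi)=S_\Psi$; (III) $\omega\in S_\Phi$, $\alpha_i(\omega)\preceq S_\Psi\preceq S_\Phi\Rightarrow\alpha_i(\omega_\Psi)=\alpha_i(\omega)$; (IV) $\omega\in S_\Phi$, $\Psi\subseteq\Phi\Rightarrow\alpha_i(\omega)\succeq\alpha_i(\omega_\Psi)$. FH$^*$-transform: $W_{\mathsf{At}}=S_{\mathsf{At}}$; $(\omega,\omega')\in R_{\mathsf{At},i}$ iff $\omega'\in\Lambda_i(\omega)$; $\mathcal{A}_{\mathsf{At},i}(\omega)=\mathcal{L}_\Phi$ where $\alpha_i(\omega)=S_\Phi$; $V_{\mathsf{At}}(p)=v(p)\cap S_{\mathsf{At}}$. An FH model for $\mathsf{At}$ is $\langle I,W,(R_i),(\mathcal{A}_i),V\rangle$ with $W\ne\emptyset$, each $R_i$ an equivalence relation on $W$, $\mathcal{A}_i:W\to2^{\mathcal{L}_{\mathsf{At}}}$, $V:\mathsf{At}\to2^W$, such that $\varphi\in\mathcal{A}_i(w)$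 iff every $p\in\mathsf{At}(\varphi)$ lies in $\mathcal{A}_i(w)$, and $(w,t)\in R_i$ implies $\mathcal{A}_i(w)=\mathcal{A}_i(t)$. -}

module Defs where

open import Level using (0ℓ; suc)
open import Data.Product using (Σ; ∃; _×_; _,_)
open import Data.Empty using (⊥)
open import Relation.Unary using (Pred; _⊆_; _≐_; _∈_; U; _∪_)
open import Relation.Binary.Core using (Rel)
open import Relation.Binary.Structures using (IsEquivalence)
open import Relation.Binary.PropositionalEquality using (_≡_)
open import Function.Bundles using (_⇔_)

data Form (At I : Set) : Set where
  ⊤′   : Form At I
  atom : At → Form At I
  ¬′_  : Form At I → Form At I
  _∧′_ : Form At I → Form At I → Form At I
  ℓ    : I → Form At I → Form At I
  a    : I → Form At I → Form At I
  k    : I → Form At I → Form At I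

atoms : ∀ {At I} → Form At I → Pred At 0ℓ
atoms ⊤′       = λ _ → ⊥
atoms (atom q) = λ p → p ≡ q
atoms (¬′ φ)   = atoms φ
atoms (φ ∧′ ψ) = atoms φ ∪ atoms ψ
atoms (ℓ _ φ)  = atoms φ
atoms (a _ φ)  = atoms φ
atoms (k _ φ)  = atoms φ

Lang : ∀ {At I} → Pred At 0ℓ → Pred (Form At I) 0ℓ
Lang Φ φ = atoms φ ⊆ Φ

-- Implicit knowledge-based HMS models
-- Subsets Φ ⊆ At are predicates Pred At 0ℓ; the space S_Φ is S Φ;
-- Ω is the disjoint union Σ Φ. S Φ; S_Φ' ⪰ S_Φ iff Φ ⊆ Φ'.

record IKHMS (At I : Set) : Set₂ where
  field
    S        : Pred At 0ℓ → Set
    S-nonempty : ∀ Φ → S Φ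
  Ω : Set₁
  Ω = Σ (Pred At 0ℓ) S
  field
    r        : ∀ {Φ Ψ} → .(Ψ ⊆ Φ) → S Φ → S Ψ
    r-surj   : ∀ {Φ Ψ} (h : Ψ ⊆ Φ) (y : S Ψ) → ∃ λ x → r h x ≡ y
    r-id     : ∀ {Φ} (h : Φ ⊆ Φ) (ω : S Φ) → r h ω ≡ ω
    r-comp   : ∀ {Φ Ψ Υ} (h₁ : Ψ ⊆ Φ) (h₂ : Υ ⊆ Ψ) (ω : S Φ) →
               r (λ z → h₁ (h₂ z)) ω ≡ r h₂ (r h₁ ω)
  -- r^Φ_Ψ(X) for X ⊆ Ω, as a subset of Ω (points of X outside S_Φ are
  -- not in the domain of r^Φ_Ψ)
  image : ∀ {Φ Ψ} → (Ψ ⊆ Φ) → Pred Ω 0ℓ → Pred Ω (suc 0ℓ)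
  image {Φ} {Ψ} h X z = ∃ λ (x : S Φ) → (Φ , x) ∈ X × (Ψ , r h x) ≡ z
  -- events: ⋃_{Φ ⊆ Ψ} (r^Ψ_Φ)^{-1}(D) with D ⊆ S_Φ
  IsEvent : Pred Ω 0ℓ → Set₁
  IsEvent E = Σ (Pred At 0ℓ) λ Φ → Σ (Pred (S Φ) 0ℓ) λ D →
    ∀ (Ψ : Pred At 0ℓ) (ω : S Ψ) →
      ((Ψ , ω) ∈ E) ⇔ (Σ (Φ ⊆ Ψ) λ h → r h ω ∈ D)
  field
    v        : At → Pred Ω 0ℓ
    v-event  : ∀ p → IsEvent (v p)
    Λ        : I → Ω → Pred Ω 0ℓ
    Λ-nonempty : ∀ i ω → ∃ λ ω′ → ω′ ∈ Λ i ω
    reflexivity : ∀ i ω → ω ∈ Λ i ω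
    stationarity : ∀ i ω ω′ → ω′ ∈ Λ i ω → Λ i ω′ ≐ Λ i ω
    ppik     : ∀ i {Φ Ψ : Pred At 0ℓ} (h : Ψ ⊆ Φ) (ω : S Φ) →
               image {Φ} {Ψ} h (Λ i (Φ , ω)) ≐ Λ i (Ψ , r h ω)
    -- awareness: α_i(ω) = S_{α i ω}
    α        : I → Ω → Pred At 0ℓ
    α-O      : ∀ i {Φ} (ω : S Φ) → α i (Φ , ω) ⊆ Φ
    α-I      : ∀ i ω ω′ → ω′ ∈ Λ i ω → α i ω′ ≐ α i ω
    α-II     : ∀ i {Φ Ψ : Pred At 0ℓ} (h : Ψ ⊆ Φ) (ω : S Φ) →
               Ψ ⊆ α i (Φ , ω) → α i (Ψ , r h ω) ≐ Ψ
    α-III    : ∀ i {Φ Ψ : Pred At 0ℓ} (h : Ψ ⊆ Φ) (ω : S Φ) →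
               α i (Φ , ω) ⊆ Ψ → α i (Ψ , r h ω) ≐ α i (Φ , ω)
    α-IV     : ∀ i {Φ Ψ : Pred At 0ℓ} (h : Ψ ⊆ Φ) (ω : S Φ) →
               α i (Ψ , r h ω) ⊆ α i (Φ , ω)

record FHStructure (At I : Set) : Set₂ where
  field
    W : Set
    R : I → Rel W 0ℓ
    A : I → W → Pred (Form At I) 0ℓ
    V : At → Pred W 0ℓ

record IsFHModel {At I : Set} (F : FHStructure At I) : Set₁ where
  open FHStructure F
  field
    W-nonempty : W
    R-equiv    : ∀ i → IsEquivalence (R i)
    prop-det   : ∀ i w (φ : Form At I) →
                 (φ ∈ A i w) ⇔ (∀ {p} → p ∈ atoms φ → atom p ∈ A i w)
    A-invariant : ∀ i w t → R i w t → A i w ≐ A i t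

FH* : ∀ {At I} → IKHMS At I → FHStructure At I
FH* {At} {I} M = record
  { W = S U
  ; R = λ i ω ω′ → (U , ω′) ∈ Λ i (U , ω)
  ; A = λ i ω → Lang (α i (U , ω))
  ; V = λ p ω → (U , ω) ∈ v p
  }
  where open IKHMS M

module Submission where

open import Level using (Level; 0ℓ)
open import Data.Product using (_,_; proj₁; proj₂)
open import Relation.Unary using (Pred; U; _∈_; _⊆_; _≐_)
open import Relation.Unary.Properties using (≐-sym)
open import Relation.Binary.Core using (Rel)
open import Relation.Binary.Structures using (IsEquivalence)
import Relation.Binary.Construct.On as On
open import Relation.Binary.PropositionalEquality using (refl)
open import Function.Bundles using (_⇔_; mk⇔)

open import Defs

-- Symmetry: if y ∈ N x then x ∈ N x ⊆ N y by stationarity.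
module _ {a ℓ : Level} {A : Set a} (N : A → Pred A ℓ)
         (reflexive : ∀ x → x ∈ N x)
         (stationary : ∀ x y → y ∈ N x → N y ≐ N x) where

  Accessible : Rel A ℓ
  Accessible x y = y ∈ N x

  reflexive∧stationary⇒isEquivalence : IsEquivalence Accessible
  reflexive∧stationary⇒isEquivalence = record
    { refl  = λ {x} → reflexive x
    ; sym   = λ {x} {y} x∼y → proj₂ (stationary x y x∼y) (reflexive x)
    ; trans = λ {x} {y} x∼y y∼z → proj₁ (stationary x y x∼y) y∼z
    }

Lang-mono : ∀ {At I : Set} {Φ Ψ : Pred At 0ℓ} → Φ ⊆ Ψ → Lang {I = I} Φ ⊆ Lang Ψ
Lang-mono Φ⊆Ψ φ∈ p∈ = Φ⊆Ψ (φ∈ p∈)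

Lang-cong : ∀ {At I : Set} {Φ Ψ : Pred At 0ℓ} → Φ ≐ Ψ → Lang {I = I} Φ ≐ Lang Ψ
Lang-cong (Φ⊆Ψ , Ψ⊆Φ) = (λ {φ} → Lang-mono Φ⊆Ψ {φ}) , (λ {φ} → Lang-mono Ψ⊆Φ {φ})

Lang-propositionallyDetermined : ∀ {At I : Set} (Φ : Pred At 0ℓ) (φ : Form At I) →
  (φ ∈ Lang Φ) ⇔ (∀ {p} → p ∈ atoms φ → atom {I = I} p ∈ Lang Φ)
Lang-propositionallyDetermined Φ φ = mk⇔
  (λ φ∈ {p} p∈ {_} → λ { refl → φ∈ p∈ })
  (λ atoms∈ {p} p∈ → atoms∈ p∈ refl)

proposition12 : {At I : Set} → At → I → (M : IKHMS At I) → IsFHModel (FH* M)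
proposition12 _ _ M = record
  { W-nonempty  = S-nonempty U
  ; R-equiv     = λ i → On.isEquivalence (U ,_)
                          (reflexive∧stationary⇒isEquivalence (Λ i) (reflexivity i) (stationarity i))
  ; prop-det    = λ i w → Lang-propositionallyDetermined (α i (U , w))
  ; A-invariant = λ i w t w∼t → Lang-cong (≐-sym (α-I i (U , w) (U , t) w∼t))
  }
  where open IKHMS M
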